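{- Let $k\in\mathbb{N}$ and let $\mathbf{A}$ be a finite $\sigma$-structure. Then there is a homomorphism $\mathbb{F}_{\mathscr{Q}_{\mathrm{conv}}}(\mathbf{A}^{\otimes k})\to[\mathbb{F}_{\mathscr{Q}_{\mathrm{conv}}}(\mathbf{A})]^{\otimes k}$.
   Context: A $\sigma$-structure $\mathbf{A}$ has domain $A$ (possibly infinite) and relations $R^{\mathbf{A}}\subseteq A^{\mathrm{ar}(R)}$; homomorphisms preserve all relations coordinatewise. For $\mathbf{a}=(a_1,\dots,a_r)$ and $\mathbf{i}=(i_1,\dots,i_k)\in[r]^k$, $\mathbf{a}_{\mathbf{i}}=(a_{i_1},\dots,a_{i_k})$. Tensor power (for any structure $\mathbf{C}$): $\mathbf{C}^{\otimes k}$ has the same symbols, where $R$ of arity $r$ gets arity $r^k$ with positions indexed by $[r]^k$; domain $C^k$; $R^{\mathbf{C}^{\otimes k}}=\{\mathbf{c}^{\otimes k}:\mathbf{c}\in R^{\mathbf{C}}\}$ with $\mathbf{c}^{\otimes k}$ the family whose $\mathbf{i}$-th entry is $\mathbf{c}_{\mathbf{i}}$. Free structure of $\mathscr{Q}_{\mathrm{conv}}$: for a finite structure $\mathbf{B}$, $\mathbb{F}_{\mathscr{Q}_{\mathrm{conv}}}(\mathbf{B})$ has domain all functions $v:B\to\mathbb{Q}_{\ge0}$ with $\sum_b v(b)=1$; for a symbol $R$ whose positions are indexed by a set $J$, a family $(v_j)_{j\in J}$ is in $R^{\mathbb{F}_{\mathscr{Q}_{\mathrm{conv}}}(\mathbf{B})}$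 iff there is a rational probability vector $q$ on $R^{\mathbf{B}}$ with $v_j(b)=\sum_{c\in R^{\mathbf{B}},\,c_j=b}q(c)$ for all $j\in J$, $b\in B$. -}

module Defs where

open import Level using (0ℓ)
open import Data.Nat using (ℕ; zero; suc)
open import Data.Fin using (Fin)
open import Data.List using (List; []; _∷_; map; concatMap; length; allFin; foldr) renaming (lookup to lookupL)
open import Data.Vec using (Vec; []; _∷_; lookup) renaming (map to mapV)
import Data.Vec.Properties as VecP
import Data.Vec.Relation.Binary.Pointwise.Inductive as PW
open import Data.Rational using (ℚ; 0ℚ; 1ℚ; _+_; _≤_)
open import Data.Product using (Σ; _×_; ∃)
open import Data.Bool using (if_then_else_)
open import Relation.Nullary.Decidable using (⌊_⌋)
open import Relation.Binary.Core using (Rel)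
open import Relation.Binary.Structures using (IsEquivalence)
open import Relation.Binary.Definitions using (DecidableEquality)
open import Relation.Binary.PropositionalEquality using (_≡_)

record Signature : Set₁ where
  field
    Sym : Set
    ar  : Sym → ℕ

-- Generalised signatures: positions of a symbol indexed by an arbitrary set J
-- (needed because the positions of R in a tensor power are indexed by [r]^k).
record GSig : Set₁ where
  field
    Sym : Set
    Pos : Sym → Set

sigPos : Signature → GSig
sigPos σ = record { Sym = Signature.Sym σ ; Pos = λ R → Fin (Signature.ar σ R) }

tensorSig : GSig → ℕ → GSig
tensorSig G k = record { Sym = GSig.Sym G ; Pos = λ R → Vec (GSig.Pos G R) k }

-- (Possibly infinite) structures; the domain carries an equality _≈_
-- (for free structures, elements are functions compared pointwise).

record Structure (G : GSig) : Set₁ where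
  field
    Carrier : Set
    _≈_     : Rel Carrier 0ℓ
    isEquivalence : IsEquivalence _≈_
    rel     : (R : GSig.Sym G) → (GSig.Pos G R → Carrier) → Set

record Homomorphism {G : GSig} (A B : Structure G) : Set₁ where
  private
    module A = Structure A
    module B = Structure B
  field
    fun       : A.Carrier → B.Carrier
    fun-cong  : ∀ {x y} → x A.≈ y → fun x B.≈ fun y
    preserves : ∀ (R : GSig.Sym G) (w : GSig.Pos G R → A.Carrier) →
                A.rel R w → B.rel R (λ j → fun (w j))

-- Tensor power C^{⊗k}: domain C^k, R holds of w iff w = c^{⊗k} for some c ∈ R^C,
-- where (c^{⊗k})_i = c_i = (c_{i_1},…,c_{i_k}).
tensorStr : {G : GSig} → Structure G → (k : ℕ) → Structure (tensorSig G k)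
tensorStr {G} C k = record
  { Carrier = Vec C.Carrier k
  ; _≈_ = PW.Pointwise C._≈_
  ; isEquivalence = PW.isEquivalence C.isEquivalence k
  ; rel = λ R w → Σ (GSig.Pos G R → C.Carrier) λ c →
            C.rel R c × (∀ i → PW.Pointwise C._≈_ (w i) (mapV c i))
  }
  where module C = Structure C

record FinStructure (G : GSig) : Set₁ where
  field
    Carrier : Set
    _≟_     : DecidableEquality Carrier
    elems   : List Carrier
    tuples  : (R : GSig.Sym G) → List (GSig.Pos G R → Carrier)

record FinSigStructure (σ : Signature) : Set where
  field
    size : ℕ
    rels : (R : Signature.Sym σ) → List (Vec (Fin size) (Signature.ar σ R))

toFin : {σ : Signature} → FinSigStructure σ → FinStructure (sigPos σ)
toFin A = record
  { Carrier = Fin (FinSigStructure.size A)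
  ; _≟_ = Data.Fin._≟_
  ; elems = allFin (FinSigStructure.size A)
  ; tuples = λ R → map lookup (FinSigStructure.rels A R)
  }
  where import Data.Fin

allVecs : {X : Set} → List X → (k : ℕ) → List (Vec X k)
allVecs xs zero = [] ∷ []
allVecs xs (suc k) = concatMap (λ x → map (x ∷_) (allVecs xs k)) xs

finTensor : {G : GSig} → FinStructure G → (k : ℕ) → FinStructure (tensorSig G k)
finTensor B k = record
  { Carrier = Vec B.Carrier k
  ; _≟_ = VecP.≡-dec B._≟_
  ; elems = allVecs B.elems k
  ; tuples = λ R → map (λ c i → mapV c i) (B.tuples R)
  }
  where module B = FinStructure B

sumℚ : List ℚ → ℚ
sumℚ = foldr _+_ 0ℚ

Free : {G : GSig} → FinStructure G → Structure G
Free {G} B = record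
  { Carrier = Σ (B.Carrier → ℚ) λ v → (∀ b → 0ℚ ≤ v b) × sumℚ (map v B.elems) ≡ 1ℚ
  ; _≈_ = λ v w → ∀ b → Data.Product.proj₁ v b ≡ Data.Product.proj₁ w b
  ; isEquivalence = record
      { refl = λ b → Eq.refl
      ; sym = λ p b → Eq.sym (p b)
      ; trans = λ p q b → Eq.trans (p b) (q b) }
  ; rel = λ R w →
      Σ (Fin (length (B.tuples R)) → ℚ) λ q →
        (∀ t → 0ℚ ≤ q t) ×
        (sumℚ (map q (allFin (length (B.tuples R)))) ≡ 1ℚ) ×
        (∀ j b → Data.Product.proj₁ (w j) b ≡
           sumℚ (map (λ t → if ⌊ lookupL (B.tuples R) t j B.≟ b ⌋ then q t else 0ℚ)
                     (allFin (length (B.tuples R)))))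
  }
  where
    module B = FinStructure B
    import Data.Product
    import Relation.Binary.PropositionalEquality as Eq

{-# OPTIONS --safe #-}
-- The homomorphism sends a distribution on A^k to its k one-dimensional marginals.
-- If (v_j) lies in R because every v_j is the pushforward of weights q on the tuples
-- c^{⊗k} (c ∈ R^A) along t ↦ t_j, then the same weights q, read on R^A, give the
-- distributions c_p (pushforward along t ↦ t_p), and since pushforwards compose,
-- the m-th marginal of v_j is c_{j_m}: the marginal vectors form the tuple c^{⊗k}.
module Submission where

open import Defs
open import Function using (_∘_; id)
open import Algebra.Bundles using (CommutativeMonoid)
open import Data.Nat using (ℕ; zero; suc)
open import Data.Fin using (Fin; zero; suc) renaming (_≟_ to _≟F_)
open import Data.List using (List; []; _∷_; map; concatMap; length; allFin; _++_; tabulate) renaming (lookup to lookupL)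
import Data.List.Properties as LP
open import Data.Vec using (Vec; []; _∷_; lookup) renaming (map to mapV; tabulate to tabulateV)
import Data.Vec.Properties as VecP
import Data.Vec.Relation.Binary.Pointwise.Inductive as PW
open import Data.Rational using (ℚ; 0ℚ; 1ℚ; _+_; _≤_)
import Data.Rational.Properties as QP
open import Data.Product using (_×_; _,_; proj₁)
open import Data.Bool using (Bool; true; false; if_then_else_)
open import Relation.Nullary.Decidable using (Dec; _because_; ⌊_⌋; _×-dec_; ⌊⌋-map′)
open import Relation.Binary.Definitions using (DecidableEquality)
open import Relation.Binary.PropositionalEquality
  using (_≡_; refl; sym; trans; cong; cong₂; subst; module ≡-Reasoning)
open import Algebra.Properties.CommutativeSemigroup
  (CommutativeMonoid.commutativeSemigroup QP.+-0-commutativeMonoid) using (interchange)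
open ≡-Reasoning

private
  variable
    X Y Z : Set

Sum : List X → (X → ℚ) → ℚ
Sum L f = sumℚ (map f L)

⟪_⟫_ : Bool → ℚ → ℚ
⟪ b ⟫ q = if b then q else 0ℚ

Sum-cong : (L : List X) {f g : X → ℚ} → (∀ x → f x ≡ g x) → Sum L f ≡ Sum L g
Sum-cong []      f≡g = refl
Sum-cong (x ∷ L) f≡g = cong₂ _+_ (f≡g x) (Sum-cong L f≡g)

Sum-zero : (L : List X) → Sum L (λ _ → 0ℚ) ≡ 0ℚ
Sum-zero []      = refl
Sum-zero (x ∷ L) = cong (0ℚ +_) (Sum-zero L)

Sum-+ : (L : List X) (f g : X → ℚ) → Sum L (λ x → f x + g x) ≡ Sum L f + Sum L g
Sum-+ []      f g = refl
Sum-+ (x ∷ L) f g =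
  trans (cong (f x + g x +_) (Sum-+ L f g)) (interchange (f x) (g x) (Sum L f) (Sum L g))

Sum-swap : (L : List X) (M : List Y) (h : X → Y → ℚ) →
           Sum L (λ x → Sum M (h x)) ≡ Sum M (λ y → Sum L (λ x → h x y))
Sum-swap []      M h = sym (Sum-zero M)
Sum-swap (x ∷ L) M h =
  trans (cong (Sum M (h x) +_) (Sum-swap L M h)) (sym (Sum-+ M (h x) (λ y → Sum L (λ x′ → h x′ y))))

Sum-++ : (L M : List X) (f : X → ℚ) → Sum (L ++ M) f ≡ Sum L f + Sum M f
Sum-++ []      M f = sym (QP.+-identityˡ _)
Sum-++ (x ∷ L) M f = trans (cong (f x +_) (Sum-++ L M f)) (sym (QP.+-assoc (f x) _ _))

Sum-map : (L : List X) (g : X → Y) (f : Y → ℚ) → Sum (map g L) f ≡ Sum L (f ∘ g)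
Sum-map L g f = cong sumℚ (sym (LP.map-∘ L))

Sum-concatMap : (L : List X) (g : X → List Y) (f : Y → ℚ) →
                Sum (concatMap g L) f ≡ Sum L (λ x → Sum (g x) f)
Sum-concatMap []      g f = refl
Sum-concatMap (x ∷ L) g f =
  trans (Sum-++ (g x) (concatMap g L) f) (cong (Sum (g x) f +_) (Sum-concatMap L g f))

Sum-allFin-suc : ∀ n (f : Fin (suc n) → ℚ) → Sum (allFin (suc n)) f ≡ f zero + Sum (allFin n) (f ∘ suc)
Sum-allFin-suc n f = cong (f zero +_) (begin
  sumℚ (map f (tabulate suc))     ≡⟨ cong sumℚ (LP.map-tabulate suc f) ⟩
  sumℚ (tabulate (f ∘ suc))       ≡⟨ cong sumℚ (LP.map-tabulate id (f ∘ suc)) ⟨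
  sumℚ (map (f ∘ suc) (allFin n)) ∎)

Sum-nonneg : (L : List X) (f : X → ℚ) → (∀ x → 0ℚ ≤ f x) → 0ℚ ≤ Sum L f
Sum-nonneg []      f f≥0 = QP.≤-refl
Sum-nonneg (x ∷ L) f f≥0 = QP.+-mono-≤ (f≥0 x) (Sum-nonneg L f f≥0)

⟪⟫-nonneg : ∀ b {q} → 0ℚ ≤ q → 0ℚ ≤ ⟪ b ⟫ q
⟪⟫-nonneg true  q≥0 = q≥0
⟪⟫-nonneg false q≥0 = QP.≤-refl

⟪⟫-Sum : ∀ b (L : List X) (f : X → ℚ) → ⟪ b ⟫ Sum L f ≡ Sum L (λ x → ⟪ b ⟫ f x)
⟪⟫-Sum true  L f = refl
⟪⟫-Sum false L f = sym (Sum-zero L)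

⟪⟫-comm : ∀ b c q → ⟪ b ⟫ ⟪ c ⟫ q ≡ ⟪ c ⟫ ⟪ b ⟫ q
⟪⟫-comm true  c     q = refl
⟪⟫-comm false true  q = refl
⟪⟫-comm false false q = refl

⟪⟫-×-dec : ∀ {A B : Set} (a? : Dec A) (b? : Dec B) q → ⟪ ⌊ a? ×-dec b? ⌋ ⟫ q ≡ ⟪ ⌊ a? ⌋ ⟫ ⟪ ⌊ b? ⌋ ⟫ q
⟪⟫-×-dec (true  because _) (true  because _) q = refl
⟪⟫-×-dec (true  because _) (false because _) q = refl
⟪⟫-×-dec (false because _) b?                q = refl

-- Sifting by the Kronecker delta: L lists every element of X exactly once.
Enumerates : DecidableEquality X → List X → Set
Enumerates {X} _≟_ L = (y : X) (h : X → ℚ) → Sum L (λ x → ⟪ ⌊ y ≟ x ⌋ ⟫ h x) ≡ h y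

allFin-enumerates : ∀ n → Enumerates _≟F_ (allFin n)
allFin-enumerates (suc n) zero h = begin
  Sum (allFin (suc n)) (λ x → ⟪ ⌊ zero ≟F x ⌋ ⟫ h x) ≡⟨ Sum-allFin-suc n (λ x → ⟪ ⌊ zero ≟F x ⌋ ⟫ h x) ⟩
  h zero + Sum (allFin n) (λ _ → 0ℚ)                 ≡⟨ cong (h zero +_) (Sum-zero (allFin n)) ⟩
  h zero + 0ℚ                                        ≡⟨ QP.+-identityʳ (h zero) ⟩
  h zero                                             ∎
allFin-enumerates (suc n) (suc y) h = begin
  Sum (allFin (suc n)) (λ x → ⟪ ⌊ suc y ≟F x ⌋ ⟫ h x)
    ≡⟨ Sum-allFin-suc n (λ x → ⟪ ⌊ suc y ≟F x ⌋ ⟫ h x) ⟩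
  0ℚ + Sum (allFin n) (λ x → ⟪ ⌊ suc y ≟F suc x ⌋ ⟫ h (suc x))
    ≡⟨ cong (0ℚ +_) (Sum-cong (allFin n) (λ x → cong (⟪_⟫ h (suc x)) (⌊⌋-map′ _ _ (y ≟F x)))) ⟩
  0ℚ + Sum (allFin n) (λ x → ⟪ ⌊ y ≟F x ⌋ ⟫ h (suc x))
    ≡⟨ cong (0ℚ +_) (allFin-enumerates n y (h ∘ suc)) ⟩
  0ℚ + h (suc y)
    ≡⟨ QP.+-identityˡ (h (suc y)) ⟩
  h (suc y) ∎

allVecs-enumerates : (_≟_ : DecidableEquality X) (L : List X) → Enumerates _≟_ L →
                     ∀ k → Enumerates (VecP.≡-dec _≟_) (allVecs L k)
allVecs-enumerates _≟_ L enum zero [] h = QP.+-identityʳ (h [])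
allVecs-enumerates {X} _≟_ L enum (suc k) (b ∷ y) h = begin
  Sum (concatMap (λ a → map (a ∷_) V) L) (λ x → ⟪ ⌊ (b ∷ y) ≟V x ⌋ ⟫ h x)
    ≡⟨ Sum-concatMap L (λ a → map (a ∷_) V) (λ x → ⟪ ⌊ (b ∷ y) ≟V x ⌋ ⟫ h x) ⟩
  Sum L (λ a → Sum (map (a ∷_) V) (λ x → ⟪ ⌊ (b ∷ y) ≟V x ⌋ ⟫ h x))
    ≡⟨ Sum-cong L (λ a → Sum-map V (a ∷_) (λ x → ⟪ ⌊ (b ∷ y) ≟V x ⌋ ⟫ h x)) ⟩
  Sum L (λ a → Sum V (λ x → ⟪ ⌊ (b ∷ y) ≟V (a ∷ x) ⌋ ⟫ h (a ∷ x)))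
    ≡⟨ Sum-cong L (λ a → Sum-cong V (λ x → ⟪⟫-∷ a x)) ⟩
  Sum L (λ a → Sum V (λ x → ⟪ ⌊ b ≟ a ⌋ ⟫ ⟪ ⌊ y ≟V x ⌋ ⟫ h (a ∷ x)))
    ≡⟨ Sum-cong L (λ a → sym (⟪⟫-Sum ⌊ b ≟ a ⌋ V (λ x → ⟪ ⌊ y ≟V x ⌋ ⟫ h (a ∷ x)))) ⟩
  Sum L (λ a → ⟪ ⌊ b ≟ a ⌋ ⟫ Sum V (λ x → ⟪ ⌊ y ≟V x ⌋ ⟫ h (a ∷ x)))
    ≡⟨ Sum-cong L (λ a → cong (⟪ ⌊ b ≟ a ⌋ ⟫_) (allVecs-enumerates _≟_ L enum k y (h ∘ (a ∷_)))) ⟩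
  Sum L (λ a → ⟪ ⌊ b ≟ a ⌋ ⟫ h (a ∷ y))
    ≡⟨ enum b (λ a → h (a ∷ y)) ⟩
  h (b ∷ y) ∎
  where
  V = allVecs L k
  _≟V_ : ∀ {m} → DecidableEquality (Vec X m)
  _≟V_ = VecP.≡-dec _≟_
  ⟪⟫-∷ : ∀ a x → ⟪ ⌊ (b ∷ y) ≟V (a ∷ x) ⌋ ⟫ h (a ∷ x) ≡ ⟪ ⌊ b ≟ a ⌋ ⟫ ⟪ ⌊ y ≟V x ⌋ ⟫ h (a ∷ x)
  ⟪⟫-∷ a x = trans (cong (⟪_⟫ h (a ∷ x)) (⌊⌋-map′ _ _ (b ≟ a ×-dec y ≟V x)))
                   (⟪⟫-×-dec (b ≟ a) (y ≟V x) (h (a ∷ x)))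

pushforward : DecidableEquality X → List Y → (Y → X) → (Y → ℚ) → X → ℚ
pushforward _≟_ L π f x = Sum L (λ y → ⟪ ⌊ π y ≟ x ⌋ ⟫ f y)

module _ (_≟_ : DecidableEquality X) (L : List Y) (π : Y → X) where

  pushforward-cong : {f g : Y → ℚ} → (∀ y → f y ≡ g y) →
                     ∀ x → pushforward _≟_ L π f x ≡ pushforward _≟_ L π g x
  pushforward-cong f≡g x = Sum-cong L (λ y → cong (⟪ ⌊ π y ≟ x ⌋ ⟫_) (f≡g y))

  pushforward-nonneg : {f : Y → ℚ} → (∀ y → 0ℚ ≤ f y) → ∀ x → 0ℚ ≤ pushforward _≟_ L π f x
  pushforward-nonneg f≥0 x = Sum-nonneg L _ (λ y → ⟪⟫-nonneg ⌊ π y ≟ x ⌋ (f≥0 y))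

  Sum-pushforward : (M : List X) → Enumerates _≟_ M →
                    ∀ f → Sum M (pushforward _≟_ L π f) ≡ Sum L f
  Sum-pushforward M enum f = begin
    Sum M (λ x → Sum L (λ y → ⟪ ⌊ π y ≟ x ⌋ ⟫ f y)) ≡⟨ Sum-swap M L _ ⟩
    Sum L (λ y → Sum M (λ x → ⟪ ⌊ π y ≟ x ⌋ ⟫ f y)) ≡⟨ Sum-cong L (λ y → enum (π y) (λ _ → f y)) ⟩
    Sum L f                                          ∎

pushforward-∘ : (_≟X_ : DecidableEquality X) (_≟Y_ : DecidableEquality Y) (M : List Y) →
                Enumerates _≟Y_ M → (L : List Z) (π : Z → Y) (ρ : Y → X) (f : Z → ℚ) →
                ∀ x → pushforward _≟X_ M ρ (pushforward _≟Y_ L π f) x ≡ pushforward _≟X_ L (ρ ∘ π) f x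
pushforward-∘ _≟X_ _≟Y_ M enum L π ρ f x = begin
  Sum M (λ y → ⟪ ⌊ ρ y ≟X x ⌋ ⟫ Sum L (λ z → ⟪ ⌊ π z ≟Y y ⌋ ⟫ f z))
    ≡⟨ Sum-cong M (λ y → ⟪⟫-Sum ⌊ ρ y ≟X x ⌋ L (λ z → ⟪ ⌊ π z ≟Y y ⌋ ⟫ f z)) ⟩
  Sum M (λ y → Sum L (λ z → ⟪ ⌊ ρ y ≟X x ⌋ ⟫ ⟪ ⌊ π z ≟Y y ⌋ ⟫ f z))
    ≡⟨ Sum-swap M L _ ⟩
  Sum L (λ z → Sum M (λ y → ⟪ ⌊ ρ y ≟X x ⌋ ⟫ ⟪ ⌊ π z ≟Y y ⌋ ⟫ f z))
    ≡⟨ Sum-cong L (λ z → Sum-cong M (λ y → ⟪⟫-comm ⌊ ρ y ≟X x ⌋ ⌊ π z ≟Y y ⌋ (f z))) ⟩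
  Sum L (λ z → Sum M (λ y → ⟪ ⌊ π z ≟Y y ⌋ ⟫ ⟪ ⌊ ρ y ≟X x ⌋ ⟫ f z))
    ≡⟨ Sum-cong L (λ z → enum (π z) (λ y → ⟪ ⌊ ρ y ≟X x ⌋ ⟫ f z)) ⟩
  Sum L (λ z → ⟪ ⌊ ρ (π z) ≟X x ⌋ ⟫ f z) ∎

IsDistribution : List X → (X → ℚ) → Set
IsDistribution L f = (∀ x → 0ℚ ≤ f x) × Sum L f ≡ 1ℚ

pushforward-isDistribution : (_≟_ : DecidableEquality X) (M : List X) → Enumerates _≟_ M →
                             (L : List Y) (π : Y → X) {f : Y → ℚ} →
                             IsDistribution L f → IsDistribution M (pushforward _≟_ L π f)
pushforward-isDistribution _≟_ M enum L π {f} (f≥0 , Σf≡1) =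
  pushforward-nonneg _≟_ L π f≥0 , trans (Sum-pushforward _≟_ L π M enum f) Σf≡1

pullWeights : (F : Y → Z) (L : List Y) → (Fin (length (map F L)) → ℚ) → Fin (length L) → ℚ
pullWeights F (y ∷ L) q zero    = q zero
pullWeights F (y ∷ L) q (suc t) = pullWeights F L (q ∘ suc) t

pullWeights-nonneg : (F : Y → Z) (L : List Y) {q : Fin (length (map F L)) → ℚ} →
                     (∀ t → 0ℚ ≤ q t) → ∀ t → 0ℚ ≤ pullWeights F L q t
pullWeights-nonneg F (y ∷ L) q≥0 zero    = q≥0 zero
pullWeights-nonneg F (y ∷ L) q≥0 (suc t) = pullWeights-nonneg F L (q≥0 ∘ suc) t

Sum-pullWeights : (F : Y → Z) (L : List Y) (q : Fin (length (map F L)) → ℚ) (g : Z → ℚ → ℚ) →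
                  Sum (allFin (length (map F L))) (λ t → g (lookupL (map F L) t) (q t)) ≡
                  Sum (allFin (length L)) (λ t → g (F (lookupL L t)) (pullWeights F L q t))
Sum-pullWeights F []      q g = refl
Sum-pullWeights F (y ∷ L) q g = begin
  Sum (allFin (suc (length (map F L)))) (λ t → g (lookupL (map F (y ∷ L)) t) (q t))
    ≡⟨ Sum-allFin-suc _ (λ t → g (lookupL (map F (y ∷ L)) t) (q t)) ⟩
  g (F y) (q zero) + Sum (allFin (length (map F L))) (λ t → g (lookupL (map F L) t) (q (suc t)))
    ≡⟨ cong (g (F y) (q zero) +_) (Sum-pullWeights F L (q ∘ suc) g) ⟩
  g (F y) (q zero) + Sum (allFin (length L)) (λ t → g (F (lookupL L t)) (pullWeights F L (q ∘ suc) t))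
    ≡⟨ Sum-allFin-suc _ (λ t → g (F (lookupL (y ∷ L) t)) (pullWeights F (y ∷ L) q t)) ⟨
  Sum (allFin (suc (length L))) (λ t → g (F (lookupL (y ∷ L) t)) (pullWeights F (y ∷ L) q t)) ∎

module _ {G : GSig} (B : FinStructure G) (k : ℕ)
         (enum : Enumerates (FinStructure._≟_ B) (FinStructure.elems B)) where
  private
    module B = FinStructure B
    module FB = Structure (Free B)
    module FBk = Structure (Free (finTensor B k))
    V = allVecs B.elems k

  marginal : Fin k → FBk.Carrier → FB.Carrier
  marginal m (f , f-dist) =
    pushforward B._≟_ V (λ x → lookup x m) f ,
    pushforward-isDistribution B._≟_ B.elems enum V (λ x → lookup x m) f-dist

  marginals : FBk.Carrier → Vec FB.Carrier k
  marginals v = tabulateV (λ m → marginal m v)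

  marginals-cong : ∀ {v v′} → v FBk.≈ v′ → PW.Pointwise FB._≈_ (marginals v) (marginals v′)
  marginals-cong v≈v′ = PW.tabulate⁺ (λ m → pushforward-cong B._≟_ V (λ x → lookup x m) v≈v′)

  marginals-preserve : ∀ R (w : Vec (GSig.Pos G R) k → FBk.Carrier) →
                       FBk.rel R w → Structure.rel (tensorStr (Free B) k) R (marginals ∘ w)
  marginals-preserve R w (q , q≥0 , Σq≡1 , w≡q*) =
    c , (q′ , q′≥0 , Σq′≡1 , λ _ _ → refl) ,
    λ j → subst (PW.Pointwise FB._≈_ (marginals (w j))) (tabulate-lookup-map c j)
                (PW.tabulate⁺ (λ m → marginal-w≡c j m))
    where
    tuples = B.tuples R
    T = allFin (length tuples)
    Ft : (GSig.Pos G R → B.Carrier) → Vec (GSig.Pos G R) k → Vec B.Carrier k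
    Ft c i = mapV c i
    q′ = pullWeights Ft tuples q
    q′≥0 : ∀ t → 0ℚ ≤ q′ t
    q′≥0 = pullWeights-nonneg Ft tuples q≥0
    Σq′≡1 : Sum T q′ ≡ 1ℚ
    Σq′≡1 = trans (sym (Sum-pullWeights Ft tuples q (λ _ r → r))) Σq≡1
    c : GSig.Pos G R → FB.Carrier
    c p = pushforward B._≟_ T (λ t → lookupL tuples t p) q′ ,
          pushforward-isDistribution B._≟_ B.elems enum T (λ t → lookupL tuples t p) (q′≥0 , Σq′≡1)
    tabulate-lookup-map : ∀ {A : Set} (f : GSig.Pos G R → A) (j : Vec (GSig.Pos G R) k) →
                          tabulateV (f ∘ lookup j) ≡ mapV f j
    tabulate-lookup-map f j = trans (VecP.tabulate-∘ f (lookup j)) (cong (mapV f) (VecP.tabulate∘lookup j))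
    marginal-w≡c : ∀ j m b → proj₁ (marginal m (w j)) b ≡ proj₁ (c (lookup j m)) b
    marginal-w≡c j m b = begin
      pushforward B._≟_ V (λ x → lookup x m) (proj₁ (w j)) b
        ≡⟨ pushforward-cong B._≟_ V (λ x → lookup x m) (w≡q* j) b ⟩
      pushforward B._≟_ V (λ x → lookup x m)
        (pushforward (VecP.≡-dec B._≟_) Tk (λ t → lookupL (map Ft tuples) t j) q) b
        ≡⟨ pushforward-∘ B._≟_ (VecP.≡-dec B._≟_) V (allVecs-enumerates B._≟_ B.elems enum k)
                         Tk (λ t → lookupL (map Ft tuples) t j) (λ x → lookup x m) q b ⟩
      Sum Tk (λ t → ⟪ ⌊ lookup (lookupL (map Ft tuples) t j) m B.≟ b ⌋ ⟫ q t)
        ≡⟨ Sum-pullWeights Ft tuples q (λ u r → ⟪ ⌊ lookup (u j) m B.≟ b ⌋ ⟫ r) ⟩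
      Sum T (λ t → ⟪ ⌊ lookup (mapV (lookupL tuples t) j) m B.≟ b ⌋ ⟫ q′ t)
        ≡⟨ Sum-cong T (λ t → cong (λ a → ⟪ ⌊ a B.≟ b ⌋ ⟫ q′ t) (VecP.lookup-map m (lookupL tuples t) j)) ⟩
      pushforward B._≟_ T (λ t → lookupL tuples t (lookup j m)) q′ b ∎
      where Tk = allFin (length (map Ft tuples))

  freeTensor⇒tensorFree : Homomorphism (Free (finTensor B k)) (tensorStr (Free B) k)
  freeTensor⇒tensorFree = record
    { fun       = marginals
    ; fun-cong  = marginals-cong
    ; preserves = marginals-preserve
    }

proposition5p4 : (σ : Signature) (A : FinSigStructure σ) (k : ℕ) →
    Homomorphism (Free (finTensor (toFin A) k)) (tensorStr (Free (toFin A)) k)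
proposition5p4 σ A k = freeTensor⇒tensorFree (toFin A) k (allFin-enumerates (FinSigStructure.size A))
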